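{- Let $m\ge1$ and let $\epsilon=(\epsilon_1,\dots,\epsilon_s)$ be a circular sequence of integers with $\epsilon_i\in\{1,-1\}$ for all $i$. Then $\ell(\Gamma^m_\epsilon)=\sum_{\lambda=1}^m a_\lambda(\epsilon)$.
   Context: Indices are mod $s$. Digraph $\Gamma^m_\epsilon$: vertices $x_{i,t}$, $0\le i\le m-1$, $t\in\{1,\dots,s\}$, some "marked zero". If $s=1$: all vertices are marked zero, no edges. If $s\ge2$: for each $t$ let $A_t=\max(\epsilon_t,0)$, $B_t=\max(-\epsilon_{t+1},0)$; for each $j\in\{0,\dots,m-1\}$: if $j\ge\max(A_t,B_t)$ add an edge from $x_{j-A_t,t}$ to $x_{j-B_t,t+1}$ of weight $A_t-B_t$; if $A_t\le j<B_t$ mark $x_{j-A_t,t}$ zero; if $B_t\le j<A_t$ mark $x_{j-B_t,t+1}$ zero. Each connected component is a directed path (linear digraph, possibly a single vertex) or a directed cycle; a linear digraph with no vertex marked zero is a free linear digraph, and $\ell(\Gamma^m_\epsilon)$ is their number. For $\lambda\ge1$, a free linear segment of level $\lambda$ of $\epsilon$ is a run of consecutive entries $\epsilon_a,\dots,\epsilon_b$ ($a\in\{1,\dots,s\}$, $a\le b$, indices mod $s$) with $\epsilon_a=-1$, $\epsilon_b=1$, $\sum_{j=a}^b\epsilon_j=0$, $-\lambda\le\sum_{j=a}^i\epsilon_j<0$ for $a\le i<b$, and $\sum_{j=a}^{i_1}\epsilon_j=-\lambda$ for some $a\le i_1<b$; $a_\lambda(\epsilon)$ is their number. -}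

module Defs where

open import Data.Nat as ℕ using (ℕ; zero; suc; _≤_; _<_; _∸_; NonZero)
open import Data.Nat.DivMod using (_mod_)
open import Data.Integer as ℤ using (ℤ; 0ℤ; 1ℤ; -1ℤ; ∣_∣)
open import Data.Fin using (Fin; toℕ)
open import Data.Product using (Σ; ∃; _×_; _,_)
open import Data.Sum using (_⊎_)
open import Data.List using (List; []; _∷_; length)
open import Data.List.Membership.Propositional using (_∈_)
open import Data.List.Relation.Unary.All using (All)
open import Data.List.Relation.Unary.Any using (Any)
open import Data.List.Relation.Unary.AllPairs using (AllPairs)
open import Data.List.Relation.Unary.Unique.Propositional using (Unique)
open import Relation.Binary.PropositionalEquality using (_≡_)
open import Relation.Binary.Construct.Closure.ReflexiveTransitive using (Star)
open import Relation.Binary.Construct.Closure.Symmetric using (SymClosure)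
open import Relation.Nullary using (¬_)
open import Function.Bundles using (_⇔_)

-- Circular sequence ε = (ε_1,…,ε_s) is represented as ε : Fin s → ℤ,
-- where the Fin index t stands for the paper's index t+1.
-- Indices are taken mod s.

module Graph (m s : ℕ) .{{_ : NonZero s}} (ε : Fin s → ℤ) where

  next : Fin s → Fin s
  next t = suc (toℕ t) mod s

  e : ℕ → ℤ
  e k = ε (k mod s)

  A : Fin s → ℕ
  A t = ∣ ε t ℤ.⊔ 0ℤ ∣

  B : Fin s → ℕ
  B t = ∣ (ℤ.- ε (next t)) ℤ.⊔ 0ℤ ∣

  V : Set
  V = Fin m × Fin s

  -- edge relation (weights are irrelevant for ℓ and omitted);
  -- there are edges only when s ≥ 2
  data Edge : V → V → Set where
    edge : ∀ (t : Fin s) (j : ℕ) (i i' : Fin m) →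
           2 ≤ s → j < m → A t ≤ j → B t ≤ j →
           toℕ i ≡ j ∸ A t → toℕ i' ≡ j ∸ B t →
           Edge (i , t) (i' , next t)

  data MarkedZero : V → Set where
    s≡1 : ∀ (v : V) → s ≡ 1 → MarkedZero v
    zeroA : ∀ (t : Fin s) (j : ℕ) (i : Fin m) →
            2 ≤ s → j < m → A t ≤ j → j < B t → toℕ i ≡ j ∸ A t →
            MarkedZero (i , t)
    zeroB : ∀ (t : Fin s) (j : ℕ) (i : Fin m) →
            2 ≤ s → j < m → B t ≤ j → j < A t → toℕ i ≡ j ∸ B t →
            MarkedZero (i , next t)

  Conn : V → V → Set
  Conn = Star (SymClosure Edge)

  data Consec (u w : V) : List V → Set where
    here  : ∀ {xs} → Consec u w (u ∷ w ∷ xs)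
    there : ∀ {x xs} → Consec u w xs → Consec u w (x ∷ xs)

  -- the connected component of v is a linear digraph (directed path,
  -- possibly a single vertex): its vertices can be listed without
  -- repetition as P = v₁ … v_k so that its edges are exactly vᵢ → vᵢ₊₁
  Linear : V → Set
  Linear v = Σ (List V) λ P →
    Unique P ×
    (∀ w → Conn v w ⇔ w ∈ P) ×
    (∀ u w → (Edge u w × u ∈ P) ⇔ Consec u w P)

  FreeLinear : V → Set
  FreeLinear v = Linear v × (∀ w → Conn v w → ¬ MarkedZero w)

  -- ℓ(Γ^m_ε) = n : there are exactly n free linear components, i.e.
  -- a list of n pairwise non-connected representatives of all of them
  NumFreeLinear : ℕ → Set
  NumFreeLinear n = Σ (List V) λ L →
    length L ≡ n ×
    All FreeLinear L ×
    AllPairs (λ u w → ¬ Conn u w) L ×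
    (∀ v → FreeLinear v → Any (Conn v) L)

  psum : ℕ → ℕ → ℤ
  psum a zero    = e a
  psum a (suc i) = psum a i ℤ.+ e (a ℕ.+ suc i)

  -- free linear segment of level λ: start a ∈ Fin s, end b = a + d
  FreeSegment : ℕ → Fin s × ℕ → Set
  FreeSegment lam (a , d) =
    e (toℕ a) ≡ -1ℤ ×
    e (toℕ a ℕ.+ d) ≡ 1ℤ ×
    psum (toℕ a) d ≡ 0ℤ ×
    (∀ i → i < d → (ℤ.- ℤ.+ lam) ℤ.≤ psum (toℕ a) i × psum (toℕ a) i ℤ.< 0ℤ) ×
    (∃ λ i → i < d × psum (toℕ a) i ≡ ℤ.- ℤ.+ lam)

  -- a_λ(ε) = n : the set of free linear segments of level λ has n elements
  NumSegments : ℕ → ℕ → Set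
  NumSegments lam n = Σ (List (Fin s × ℕ)) λ L →
    length L ≡ n × Unique L × (∀ x → x ∈ L ⇔ FreeSegment lam x)

sum1to : ℕ → (ℕ → ℕ) → ℕ
sum1to zero    f = 0
sum1to (suc k) f = sum1to k f ℕ.+ f (suc k)

-- For ±1 entries, an edge leaving x_{i,t} passes through j = i + A_t
-- and enters the next column at height j − B_t.  Start at the top vertex
-- x_{m−1,a} of a column with ε_a = −1 and keep following edges: after k steps
-- j equals m + (ε_a + … + ε_{a+k}) as long as this partial sum stays in
-- [−m, 0).  So the walk is a directed path that ends exactly when the sum
-- returns to 0, i.e. at the end of the free linear segment starting at a,
-- and its level λ ≤ m is minus the minimal partial sum.  Conversely, the
-- first vertex of a free linear component has no incoming edge and no mark,
-- which forces it to be such a top vertex; the walk from it must close a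
-- segment, since partial sums that stay negative for m + 1 periods drop
-- below −m.  Hence a ↦ x_{m−1,a} is a bijection from the free segments of
-- levels 1, …, m onto the free linear components.

module Submission where

open import Defs
open import Data.Nat as ℕ using (ℕ; zero; suc; _≤_; _<_; _∸_; NonZero; z≤n; s≤s; _%_; _/_)
import Data.Nat.Properties as ℕP
open import Data.Nat.DivMod
  using (_mod_; m%n<n; m<n⇒m%n≡m; %-distribˡ-+; m%n%n≡m%n; [m+n]%n≡m%n; m≡m%n+[m/n]*n)
open import Data.Nat.Divisibility using (_∣_; divides; n∣m⇒m%n≡0)
open import Data.Integer as ℤ using (ℤ; 0ℤ; 1ℤ; -1ℤ; ∣_∣; +_; -[1+_])
import Data.Integer.Properties as ℤP
open import Algebra.Bundles using (AbelianGroup)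
open import Algebra.Properties.Group (AbelianGroup.group ℤP.+-0-abelianGroup)
  using (∙-cancelˡ; ∙-cancelʳ)
open import Data.Fin using (Fin; toℕ)
import Data.Fin.Properties as FP
open import Data.Product using (Σ; _×_; _,_; proj₁; proj₂)
open import Data.Sum using (_⊎_; inj₁; inj₂)
open import Data.Empty using (⊥; ⊥-elim)
open import Data.List
  using (List; []; _∷_; applyUpTo; _++_; map; filter; length; cartesianProduct; allFin; upTo)
open import Data.List.Properties using (length-++; length-map)
open import Data.List.Relation.Unary.All as All using (All; []; _∷_)
import Data.List.Relation.Unary.All.Properties as AllP
open import Data.List.Relation.Unary.Any as Any using (here; there)
open import Data.List.Relation.Unary.AllPairs using (AllPairs; []; _∷_)
import Data.List.Relation.Unary.AllPairs.Properties as APP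
open import Data.List.Relation.Unary.Unique.Propositional using (Unique)
import Data.List.Relation.Unary.Unique.Propositional.Properties as UP
open import Data.List.Membership.Propositional using (_∈_)
open import Data.List.Membership.Propositional.Properties
  using ( ∈-applyUpTo⁺; ∈-applyUpTo⁻; ∈-++⁺ˡ; ∈-++⁺ʳ; ∈-++⁻; ∈-map⁺; ∈-filter⁺; ∈-filter⁻
        ; ∈-cartesianProduct⁺; ∈-allFin; ∈-upTo⁺)
open import Relation.Nullary using (¬_; Dec; yes; no)
open import Relation.Nullary.Decidable using (_×-dec_; map′)
open import Relation.Binary.Definitions using (tri<; tri≈; tri>)
open import Relation.Binary.PropositionalEquality
  using (_≡_; _≢_; refl; sym; trans; cong; cong₂; subst; subst₂; module ≡-Reasoning)
import Relation.Binary.Construct.Closure.ReflexiveTransitive as RT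
open import Relation.Binary.Construct.Closure.Symmetric using (SymClosure; fwd; bwd)
open import Function using (case_of_)
open import Function.Bundles using (_⇔_; mk⇔; Equivalence)

-i+[i+x]≡x : ∀ i x → ℤ.- i ℤ.+ (i ℤ.+ x) ≡ x
-i+[i+x]≡x i x = begin
  ℤ.- i ℤ.+ (i ℤ.+ x) ≡⟨ ℤP.+-assoc (ℤ.- i) i x ⟨
  (ℤ.- i ℤ.+ i) ℤ.+ x ≡⟨ cong (ℤ._+ x) (ℤP.+-inverseˡ i) ⟩
  0ℤ ℤ.+ x            ≡⟨ ℤP.+-identityˡ x ⟩
  x                   ∎
  where open ≡-Reasoning

ℤ-cancelˡ-≤ : ∀ i {j k} → i ℤ.+ j ℤ.≤ i ℤ.+ k → j ℤ.≤ k
ℤ-cancelˡ-≤ i {j} {k} le =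
  subst₂ ℤ._≤_ (-i+[i+x]≡x i j) (-i+[i+x]≡x i k) (ℤP.+-monoʳ-≤ (ℤ.- i) le)

-- The walk heights are natural numbers n that encode integer partial sums P
-- relative to the level m, as n = m + P.  These lemmas translate facts about
-- P into facts about n and back.
module Encoding (m : ℕ) where

  record Encodes (n : ℕ) (P : ℤ) : Set where
    constructor encodes
    field decode : + n ≡ + m ℤ.+ P

  module _ {n : ℕ} {P : ℤ} (E : Encodes n P) where
    open Encodes E

    below-m : P ℤ.< 0ℤ → n < m
    below-m lt = ℤP.drop‿+<+ (subst₂ ℤ._<_ (sym decode) (ℤP.+-identityʳ (+ m)) (ℤP.+-monoʳ-< (+ m) lt))

    -- Heights are non-negative, so encoded sums never drop below −m.
    above-−m : ℤ.- (+ m) ℤ.≤ P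
    above-−m = ℤ-cancelˡ-≤ (+ m) (subst₂ ℤ._≤_ (sym (ℤP.+-inverseʳ (+ m))) decode (ℤ.+≤+ z≤n))

    at-m : P ≡ 0ℤ → n ≡ m
    at-m eq = ℤP.+-injective (trans decode (trans (cong (λ z → + m ℤ.+ z) eq) (ℤP.+-identityʳ (+ m))))

    encodes-up : Encodes (n ℕ.+ 1) (P ℤ.+ 1ℤ)
    encodes-up = encodes (trans (cong (ℤ._+ 1ℤ) decode) (ℤP.+-assoc (+ m) P 1ℤ))

    positive : ℤ.- (+ m) ℤ.≤ P ℤ.+ -1ℤ → 1 ≤ n
    positive le = nonzero n decode
      where
      nonzero : ∀ n′ → + n′ ≡ + m ℤ.+ P → 1 ≤ n′
      nonzero (suc _) _ = s≤s z≤n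
      nonzero zero E₀ = ⊥-elim (ℤP.<⇒≱ (ℤ.-<+ {0} {0})
        (subst₂ ℤ._≤_ (ℤP.+-inverseʳ (+ m)) m+[P-1]≡-1 (ℤP.+-monoʳ-≤ (+ m) le)))
        where
        m+[P-1]≡-1 : + m ℤ.+ (P ℤ.+ -1ℤ) ≡ -1ℤ
        m+[P-1]≡-1 = trans (sym (ℤP.+-assoc (+ m) P -1ℤ)) (cong (ℤ._+ -1ℤ) (sym E₀))

    encodes-down : 1 ≤ n → Encodes (n ∸ 1 ℕ.+ 0) (P ℤ.+ -1ℤ)
    encodes-down le = encodes (trans (cong +_ (ℕP.+-identityʳ (n ∸ 1)))
      (trans (sym (ℤP.⊖-≥ le)) (trans (cong (ℤ._+ -1ℤ) decode) (ℤP.+-assoc (+ m) P -1ℤ))))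

  m-encodes-0 : Encodes m 0ℤ
  m-encodes-0 = encodes (sym (ℤP.+-identityʳ (+ m)))

negative-view : ∀ x → x ℤ.< 0ℤ → Σ ℕ λ q → x ≡ -[1+ q ]
negative-view (+ n)    (ℤ.+<+ ())
negative-view -[1+ q ] _ = q , refl

negative⇒≤-1 : ∀ {x} → x ℤ.< 0ℤ → x ℤ.≤ -1ℤ
negative⇒≤-1 {x} lt with negative-view x lt
... | q , refl = ℤ.-≤- z≤n

-[1+m]<-m : ∀ m → ¬ (ℤ.- (+ m) ℤ.≤ -[1+ m ])
-[1+m]<-m zero    ()
-[1+m]<-m (suc m) le = ℕP.<-irrefl refl (ℤP.drop‿-≤- le)

<-suc-cases : ∀ {P : ℕ → Set} {n} → (∀ j → j < n → P j) → P n → ∀ j → j < suc n → P j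
<-suc-cases below at j j<1+n with ℕP.m≤n⇒m<n∨m≡n (ℕP.≤-pred j<1+n)
... | inj₁ j<n  = below j j<n
... | inj₂ refl = at

minimiser : (f : ℕ → ℤ) → ∀ n → 1 ≤ n → Σ ℕ λ i → i < n × (∀ j → j < n → f i ℤ.≤ f j)
minimiser f (suc zero) _ = 0 , s≤s z≤n , λ { zero _ → ℤP.≤-refl ; (suc j) (s≤s ()) }
minimiser f (suc (suc n)) _ with minimiser f (suc n) (s≤s z≤n)
... | i , i<n , min with f i ℤ.≤? f (suc n)
...   | yes le = i , ℕP.m≤n⇒m≤1+n i<n , <-suc-cases min le
...   | no nle = suc n , ℕP.≤-refl , <-suc-cases (λ j j<n → ℤP.≤-trans fn<fi (min j j<n)) ℤP.≤-refl
  where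
  fn<fi : f (suc n) ℤ.≤ f i
  fn<fi = ℤP.<⇒≤ (ℤP.≰⇒> nle)

unique⇒allPairs : ∀ {A : Set} {R : A → A → Set} (Q : A → Set) {xs : List A} → All Q xs → Unique xs →
  (∀ {x y} → Q x → Q y → x ≢ y → R x y) → AllPairs R xs
unique⇒allPairs Q [] [] _ = []
unique⇒allPairs {R = R} Q {x ∷ xs} (qx ∷ qxs) (x∉xs ∷ u) h = related qxs x∉xs ∷ unique⇒allPairs Q qxs u h
  where
  related : ∀ {ys} → All Q ys → All (x ≢_) ys → All (R x) ys
  related [] [] = []
  related (qy ∷ qys) (ne ∷ nes) = h qx qy ne ∷ related qys nes

-- Columns of the circular sequence: natural indices read modulo s.
module Circular (s : ℕ) .{{_ : NonZero s}} where

  s≥1 : 1 ≤ s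
  s≥1 = ℕ.>-nonZero⁻¹ s

  col : ℕ → Fin s
  col k = k mod s

  -- the successor column; definitionally the same as Graph.next
  next : Fin s → Fin s
  next t = suc (toℕ t) mod s

  toℕ-col : ∀ k → toℕ (col k) ≡ k % s
  toℕ-col k = FP.toℕ-fromℕ< (m%n<n k s)

  col-toℕ : ∀ t → col (toℕ t) ≡ t
  col-toℕ t = FP.toℕ-injective (trans (toℕ-col (toℕ t)) (m<n⇒m%n≡m (FP.toℕ<n t)))

  %≡⇒col≡ : ∀ {x y} → x % s ≡ y % s → col x ≡ col y
  %≡⇒col≡ eq = FP.toℕ-injective (trans (toℕ-col _) (trans eq (sym (toℕ-col _))))

  col≡⇒%≡ : ∀ {x y} → col x ≡ col y → x % s ≡ y % s
  col≡⇒%≡ {x} {y} eq = trans (sym (toℕ-col x)) (trans (cong toℕ eq) (toℕ-col y))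

  next-col : ∀ k → next (col k) ≡ col (suc k)
  next-col k = %≡⇒col≡ (begin
      suc (toℕ (col k)) % s         ≡⟨ cong (λ z → suc z % s) (toℕ-col k) ⟩
      (1 ℕ.+ k % s) % s             ≡⟨ %-distribˡ-+ 1 (k % s) s ⟩
      (1 % s ℕ.+ k % s % s) % s     ≡⟨ cong (λ z → (1 % s ℕ.+ z) % s) (m%n%n≡m%n k s) ⟩
      (1 % s ℕ.+ k % s) % s         ≡⟨ %-distribˡ-+ 1 k s ⟨
      suc k % s                     ∎)
    where open ≡-Reasoning

  col-periodic : ∀ k → col (k ℕ.+ s) ≡ col k
  col-periodic k = %≡⇒col≡ ([m+n]%n≡m%n k s)

  shift-mod-injective : ∀ x δ → δ < s → (x ℕ.+ δ) % s ≡ x % s → δ ≡ 0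
  shift-mod-injective x δ δ<s eq = trans (sym (m<n⇒m%n≡m δ<s)) (n∣m⇒m%n≡0 δ s s∣δ)
    where
    open ≡-Reasoning
    q q′ : ℕ
    q  = (x ℕ.+ δ) / s
    q′ = x / s
    δ+q′s≡qs : δ ℕ.+ q′ ℕ.* s ≡ q ℕ.* s
    δ+q′s≡qs = ℕP.+-cancelˡ-≡ (x % s) _ _ (begin
      x % s ℕ.+ (δ ℕ.+ q′ ℕ.* s)  ≡⟨ ℕP.+-comm (x % s) _ ⟩
      δ ℕ.+ q′ ℕ.* s ℕ.+ x % s    ≡⟨ ℕP.+-assoc δ _ _ ⟩
      δ ℕ.+ (q′ ℕ.* s ℕ.+ x % s)  ≡⟨ cong (δ ℕ.+_) (ℕP.+-comm _ (x % s)) ⟩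
      δ ℕ.+ (x % s ℕ.+ q′ ℕ.* s)  ≡⟨ cong (δ ℕ.+_) (m≡m%n+[m/n]*n x s) ⟨
      δ ℕ.+ x                     ≡⟨ ℕP.+-comm δ x ⟩
      x ℕ.+ δ                     ≡⟨ m≡m%n+[m/n]*n (x ℕ.+ δ) s ⟩
      (x ℕ.+ δ) % s ℕ.+ q ℕ.* s   ≡⟨ cong (ℕ._+ q ℕ.* s) eq ⟩
      x % s ℕ.+ q ℕ.* s           ∎)
    s∣δ : s ∣ δ
    s∣δ = divides (q ∸ q′) (begin
      δ                                  ≡⟨ ℕP.m+n∸n≡m δ (q′ ℕ.* s) ⟨
      δ ℕ.+ q′ ℕ.* s ∸ q′ ℕ.* s          ≡⟨ cong (_∸ q′ ℕ.* s) δ+q′s≡qs ⟩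
      q ℕ.* s ∸ q′ ℕ.* s                 ≡⟨ ℕP.*-distribʳ-∸ s q q′ ⟨
      (q ∸ q′) ℕ.* s                     ∎)

  offset-injective : ∀ a {i j} → i ≤ j → j < s → (a ℕ.+ j) % s ≡ (a ℕ.+ i) % s → j ≡ i
  offset-injective a {i} {j} i≤j j<s eq = trans (sym (ℕP.m∸n+n≡m i≤j)) (cong (ℕ._+ i) j∸i≡0)
    where
    j∸i≡0 : j ∸ i ≡ 0
    j∸i≡0 = shift-mod-injective (a ℕ.+ i) (j ∸ i) (ℕP.≤-<-trans (ℕP.m∸n≤m j i) j<s)
      (trans (cong (_% s) (trans (ℕP.+-assoc a i (j ∸ i)) (cong (a ℕ.+_) (ℕP.m+[n∸m]≡n i≤j)))) eq)

  col-injective : ∀ a k k′ → k < s → k′ < s → col (a ℕ.+ k) ≡ col (a ℕ.+ k′) → k ≡ k′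
  col-injective a k k′ k<s k′<s eq with ℕP.≤-total k k′
  ... | inj₁ k≤k′ = sym (offset-injective a k≤k′ k′<s (sym (col≡⇒%≡ eq)))
  ... | inj₂ k′≤k = offset-injective a k′≤k k<s (col≡⇒%≡ eq)

  next-injective : ∀ {t t′} → next t ≡ next t′ → t ≡ t′
  next-injective {t} {t′} eq = FP.toℕ-injective (col-injective 1 (toℕ t) (toℕ t′) (FP.toℕ<n t) (FP.toℕ<n t′) eq)

  prev : Fin s → Fin s
  prev t = col (toℕ t ℕ.+ (s ∸ 1))

  next-prev : ∀ t → next (prev t) ≡ t
  next-prev t = trans (next-col _) (trans (cong col 1+t+[s-1]≡t+s) (trans (col-periodic (toℕ t)) (col-toℕ t)))
    where
    1+t+[s-1]≡t+s : suc (toℕ t ℕ.+ (s ∸ 1)) ≡ toℕ t ℕ.+ s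
    1+t+[s-1]≡t+s = trans (sym (ℕP.+-suc (toℕ t) (s ∸ 1))) (cong (toℕ t ℕ.+_) (ℕP.m+[n∸m]≡n s≥1))

  single-column : s ≤ 1 → ∀ (x y : Fin s) → x ≡ y
  single-column le x y = FP.toℕ-injective (trans (is-0 x) (sym (is-0 y)))
    where
    is-0 : ∀ (z : Fin s) → toℕ z ≡ 0
    is-0 z = ℕP.n<1⇒n≡0 (ℕP.<-≤-trans (FP.toℕ<n z) le)

module PlusMinus (m s : ℕ) .{{nz : NonZero s}} (ε : Fin s → ℤ)
  (pm : ∀ t → ε t ≡ 1ℤ ⊎ ε t ≡ -1ℤ) where

  open Graph m s ε
  open Circular s hiding (next)

  A-up : ∀ {t} → ε t ≡ 1ℤ → A t ≡ 1
  A-up eq = cong (λ z → ∣ z ℤ.⊔ 0ℤ ∣) eq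

  A-down : ∀ {t} → ε t ≡ -1ℤ → A t ≡ 0
  A-down eq = cong (λ z → ∣ z ℤ.⊔ 0ℤ ∣) eq

  B-up : ∀ {t} → ε (next t) ≡ 1ℤ → B t ≡ 0
  B-up eq = cong (λ z → ∣ (ℤ.- z) ℤ.⊔ 0ℤ ∣) eq

  B-down : ∀ {t} → ε (next t) ≡ -1ℤ → B t ≡ 1
  B-down eq = cong (λ z → ∣ (ℤ.- z) ℤ.⊔ 0ℤ ∣) eq

  A≤1 : ∀ t → A t ≤ 1
  A≤1 t with pm t
  ... | inj₁ eq = ℕP.≤-reflexive (A-up eq)
  ... | inj₂ eq = subst (_≤ 1) (sym (A-down eq)) z≤n

  B≤1 : ∀ t → B t ≤ 1
  B≤1 t with pm (next t)
  ... | inj₁ eq = subst (_≤ 1) (sym (B-up eq)) z≤n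
  ... | inj₂ eq = ℕP.≤-reflexive (B-down eq)

  edge⁻ : ∀ {i t i′ t′} → Edge (i , t) (i′ , t′) →
    2 ≤ s × t′ ≡ next t × toℕ i ℕ.+ A t ≡ toℕ i′ ℕ.+ B t × toℕ i ℕ.+ A t < m
  edge⁻ (edge t j i i′ 2≤s j<m A≤j B≤j i≡ i′≡) =
    2≤s , refl , trans i+A≡j (sym i′+B≡j) , subst (_< m) (sym i+A≡j) j<m
    where
    i+A≡j : toℕ i ℕ.+ A t ≡ j
    i+A≡j = trans (cong (ℕ._+ A t) i≡) (ℕP.m∸n+n≡m A≤j)
    i′+B≡j : toℕ i′ ℕ.+ B t ≡ j
    i′+B≡j = trans (cong (ℕ._+ B t) i′≡) (ℕP.m∸n+n≡m B≤j)

  edge⁺ : ∀ (t : Fin s) (i i′ : Fin m) → 2 ≤ s → toℕ i ℕ.+ A t < m → B t ≤ toℕ i ℕ.+ A t →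
    toℕ i′ ≡ toℕ i ℕ.+ A t ∸ B t → Edge (i , t) (i′ , next t)
  edge⁺ t i i′ 2≤s lt le eq =
    edge t (toℕ i ℕ.+ A t) i i′ 2≤s lt (ℕP.m≤n+m (A t) (toℕ i)) le (sym (ℕP.m+n∸n≡m (toℕ i) (A t))) eq

  marked⁻ : ∀ {i t} → MarkedZero (i , t) → s ≡ 1 ⊎ (toℕ i ℕ.+ A t < B t) ⊎
    (Σ (Fin s) λ t₀ → t ≡ next t₀ × toℕ i ℕ.+ B t₀ < A t₀)
  marked⁻ (s≡1 _ eq) = inj₁ eq
  marked⁻ (zeroA t j i _ _ A≤j j<B i≡) =
    inj₂ (inj₁ (subst (_< B t) (sym (trans (cong (ℕ._+ A t) i≡) (ℕP.m∸n+n≡m A≤j))) j<B))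
  marked⁻ (zeroB t j i _ _ B≤j j<A i≡) =
    inj₂ (inj₂ (t , refl , subst (_< A t) (sym (trans (cong (ℕ._+ B t) i≡) (ℕP.m∸n+n≡m B≤j))) j<A))

  markedA⁺ : ∀ (t : Fin s) (i : Fin m) → 2 ≤ s → toℕ i ℕ.+ A t < m → toℕ i ℕ.+ A t < B t → MarkedZero (i , t)
  markedA⁺ t i 2≤s lt lt′ =
    zeroA t (toℕ i ℕ.+ A t) i 2≤s lt (ℕP.m≤n+m (A t) (toℕ i)) lt′ (sym (ℕP.m+n∸n≡m (toℕ i) (A t)))

  edge-functional : ∀ {u w w′} → Edge u w → Edge u w′ → w ≡ w′
  edge-functional E E′ with edge⁻ E | edge⁻ E′
  ... | _ , refl , h , _ | _ , refl , h′ , _ =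
    cong (_, _) (FP.toℕ-injective (ℕP.+-cancelʳ-≡ _ _ _ (trans (sym h) h′)))

  edge-injective : ∀ {u u′ w} → Edge u w → Edge u′ w → u ≡ u′
  edge-injective E E′ with edge⁻ E | edge⁻ E′
  ... | _ , c , h , _ | _ , c′ , h′ , _ with next-injective (trans (sym c) c′)
  ... | refl = cong (_, _) (FP.toℕ-injective (ℕP.+-cancelʳ-≡ _ _ _ (trans h (sym h′))))

  psum-split : ∀ a x y → psum a (suc (x ℕ.+ y)) ≡ psum a x ℤ.+ psum (a ℕ.+ suc x) y
  psum-split a x zero rewrite ℕP.+-identityʳ x = refl
  psum-split a x (suc y) rewrite ℕP.+-suc x y = begin
      psum a (suc (x ℕ.+ y)) ℤ.+ e (a ℕ.+ suc (suc (x ℕ.+ y)))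
    ≡⟨ cong (ℤ._+ _) (psum-split a x y) ⟩
      psum a x ℤ.+ psum (a ℕ.+ suc x) y ℤ.+ e (a ℕ.+ suc (suc (x ℕ.+ y)))
    ≡⟨ ℤP.+-assoc (psum a x) _ _ ⟩
      psum a x ℤ.+ (psum (a ℕ.+ suc x) y ℤ.+ e (a ℕ.+ suc (suc (x ℕ.+ y))))
    ≡⟨ cong (λ z → psum a x ℤ.+ (psum (a ℕ.+ suc x) y ℤ.+ e z)) index ⟩
      psum a x ℤ.+ psum (a ℕ.+ suc x) (suc y)
    ∎
    where
    open ≡-Reasoning
    index : a ℕ.+ suc (suc (x ℕ.+ y)) ≡ a ℕ.+ suc x ℕ.+ suc y
    index = trans (cong (λ z → a ℕ.+ suc z) (sym (ℕP.+-suc x y))) (sym (ℕP.+-assoc a (suc x) (suc y)))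

  psum-periodic : ∀ a i → psum (a ℕ.+ s) i ≡ psum a i
  psum-periodic a zero    = cong ε (col-periodic a)
  psum-periodic a (suc i) = cong₂ ℤ._+_ (psum-periodic a i) (trans (cong e index) (cong ε (col-periodic _)))
    where
    index : a ℕ.+ s ℕ.+ suc i ≡ a ℕ.+ suc i ℕ.+ s
    index = trans (ℕP.+-assoc a s (suc i))
              (trans (cong (a ℕ.+_) (ℕP.+-comm s (suc i))) (sym (ℕP.+-assoc a (suc i) s)))

  consec⁻ : ∀ {u x} (f : ℕ → V) n → Consec u x (applyUpTo f n) →
    Σ ℕ λ i → suc i < n × u ≡ f i × x ≡ f (suc i)
  consec⁻ f (suc (suc n)) here = 0 , s≤s (s≤s z≤n) , refl , refl
  consec⁻ f (suc (suc n)) (there p) with consec⁻ (λ k → f (suc k)) (suc n) p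
  ... | i , lt , u≡ , x≡ = suc i , s≤s lt , u≡ , x≡
  consec⁻ f (suc zero) (there ())

  consec⁺ : ∀ (f : ℕ → V) n i → suc i < n → Consec (f i) (f (suc i)) (applyUpTo f n)
  consec⁺ f (suc (suc n)) zero    lt       = here
  consec⁺ f (suc (suc n)) (suc i) (s≤s lt) = there (consec⁺ (λ k → f (suc k)) (suc n) i lt)
  consec⁺ f (suc zero)    zero    (s≤s ())

  -- The walk that starts at the top vertex x_{m−1,a} of a column a with
  -- ε_a = −1 and keeps following edges: after k steps it is in column
  -- a + k at height H k, and (as long as the partial sums stay ≥ −m) the
  -- quantity J k = H k + A_{a+k} equals m + ε_a + … + ε_{a+k}.
  module Walk {{nzm : NonZero m}} (a : Fin s) (εa : ε a ≡ -1ℤ) where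
    open Encoding m

    m≥1 : 1 ≤ m
    m≥1 = ℕ.>-nonZero⁻¹ m

    m-1<m : m ∸ 1 < m
    m-1<m = subst (m ∸ 1 <_) (ℕP.m+[n∸m]≡n m≥1) (ℕP.n<1+n (m ∸ 1))

    c : ℕ → Fin s
    c k = col (toℕ a ℕ.+ k)

    c-suc : ∀ k → next (c k) ≡ c (suc k)
    c-suc k = trans (next-col (toℕ a ℕ.+ k)) (cong col (sym (ℕP.+-suc (toℕ a) k)))

    c0 : c 0 ≡ a
    c0 = trans (cong col (ℕP.+-identityʳ (toℕ a))) (col-toℕ a)

    P : ℕ → ℤ
    P = psum (toℕ a)

    P0 : P 0 ≡ -1ℤ
    P0 = trans (cong ε (col-toℕ a)) εa

    εc0 : ε (c 0) ≡ -1ℤ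
    εc0 = trans (cong ε c0) εa

    α β : ℕ → ℕ
    α k = A (c k)
    β k = B (c k)

    H J : ℕ → ℕ
    H zero    = m ∸ 1
    H (suc k) = J k ∸ β k
    J k = H k ℕ.+ α k

    w : ℕ → V
    w k = (H k mod m , c k)

    toℕ-w : ∀ k → H k < m → toℕ (proj₁ (w k)) ≡ H k
    toℕ-w k lt = trans (FP.toℕ-fromℕ< (m%n<n (H k) m)) (m<n⇒m%n≡m lt)

    β-up : ∀ k → ε (c (suc k)) ≡ 1ℤ → β k ≡ 0
    β-up k eq = B-up (trans (cong ε (c-suc k)) eq)

    β-down : ∀ k → ε (c (suc k)) ≡ -1ℤ → β k ≡ 1
    β-down k eq = B-down (trans (cong ε (c-suc k)) eq)

    walk-edge : ∀ k → 2 ≤ s → J k < m → β k ≤ J k → H (suc k) < m → Edge (w k) (w (suc k))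
    walk-edge k 2≤s lt le lt′ = subst (λ t → Edge (w k) (proj₁ (w (suc k)) , t)) (c-suc k)
        (edge⁺ (c k) (proj₁ (w k)) (proj₁ (w (suc k))) 2≤s
          (subst (λ z → z ℕ.+ α k < m) (sym hk) lt)
          (subst (λ z → β k ≤ z ℕ.+ α k) (sym hk) le)
          (trans (toℕ-w (suc k) lt′) (cong (λ z → z ℕ.+ α k ∸ β k) (sym hk))))
      where
      hk : toℕ (proj₁ (w k)) ≡ H k
      hk = toℕ-w k (ℕP.≤-<-trans (ℕP.m≤m+n (H k) (α k)) lt)

    J-encodes : ∀ k → (∀ i → i ≤ k → ℤ.- (+ m) ℤ.≤ P i) → Encodes (J k) (P k)
    J-encodes zero _ = subst (λ z → Encodes (m ∸ 1 ℕ.+ z) (P 0)) (sym (A-down εc0))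
      (subst (Encodes (m ∸ 1 ℕ.+ 0)) (sym P0) (encodes-down m-encodes-0 m≥1))
    J-encodes (suc k) lower = next-step (pm (c (suc k)))
      where
      IH : Encodes (J k) (P k)
      IH = J-encodes k (λ i i≤k → lower i (ℕP.m≤n⇒m≤1+n i≤k))
      -- J (suc k) = J k − β k + α (suc k), and the signs fix α and β
      step-up : ∀ {x y z v} → Encodes x (P k) → y ≡ 1 → z ≡ 0 → v ≡ 1ℤ → Encodes (x ∸ z ℕ.+ y) (P k ℤ.+ v)
      step-up E refl refl refl = encodes-up E
      step-down : ∀ {x y z v} → Encodes x (P k) → ℤ.- (+ m) ℤ.≤ P k ℤ.+ v →
        y ≡ 0 → z ≡ 1 → v ≡ -1ℤ → Encodes (x ∸ z ℕ.+ y) (P k ℤ.+ v)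
      step-down E lo refl refl refl = encodes-down E (positive E lo)
      next-step : ε (c (suc k)) ≡ 1ℤ ⊎ ε (c (suc k)) ≡ -1ℤ → Encodes (J (suc k)) (P (suc k))
      next-step (inj₁ up)   = step-up IH (A-up up) (β-up k up) up
      next-step (inj₂ down) = step-down IH (lower (suc k) ℕP.≤-refl) (A-down down) (β-down k down) down

    Run : ℕ → Set
    Run d = P d ≡ 0ℤ × (∀ i → i < d → ℤ.- (+ m) ℤ.≤ P i × P i ℤ.< 0ℤ)

    module Along (d : ℕ) (R : Run d) where

      P-above : ∀ i → i ≤ d → ℤ.- (+ m) ℤ.≤ P i
      P-above i i≤d with ℕP.m≤n⇒m<n∨m≡n i≤d
      ... | inj₁ i<d  = proj₁ (proj₂ R i i<d)
      ... | inj₂ refl = subst (ℤ.- (+ m) ℤ.≤_) (sym (proj₁ R)) (ℤP.neg-≤-pos {m} {0})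

      J-encodes-along : ∀ k → k ≤ d → Encodes (J k) (P k)
      J-encodes-along k k≤d = J-encodes k (λ i i≤k → P-above i (ℕP.≤-trans i≤k k≤d))

      J<m : ∀ k → k < d → J k < m
      J<m k k<d = below-m (J-encodes-along k (ℕP.<⇒≤ k<d)) (proj₂ (proj₂ R k k<d))

      d≥1 : 1 ≤ d
      d≥1 = nonempty d (proj₁ R)
        where
        nonempty : ∀ d′ → P d′ ≡ 0ℤ → 1 ≤ d′
        nonempty zero    P0≡0 = ⊥-elim (ℤP.<-irrefl (trans (sym P0) P0≡0) ℤ.-<+)
        nonempty (suc _) _    = s≤s z≤n

      ε-end : ε (c d) ≡ 1ℤ
      ε-end = last-step d refl d≥1
        where
        last-step : ∀ d′ → d′ ≡ d → 1 ≤ d′ → ε (c d) ≡ 1ℤ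
        last-step (suc d′) refl _ with pm (c (suc d′))
        ... | inj₁ up   = up
        ... | inj₂ down = ⊥-elim (ℤP.<-irrefl (trans (cong (λ z → P d′ ℤ.+ z) (sym down)) (proj₁ R))
                (ℤP.+-mono-<-≤ (proj₂ (proj₂ R d′ ℕP.≤-refl)) (ℤ.-≤+ {0} {0})))

      α-end : α d ≡ 1
      α-end = A-up ε-end

      J-end : J d ≡ m
      J-end = at-m (J-encodes-along d ℕP.≤-refl) (proj₁ R)

      H-end : H d ℕ.+ 1 ≡ m
      H-end = trans (cong (H d ℕ.+_) (sym α-end)) J-end

      H<m : ∀ k → k ≤ d → H k < m
      H<m k k≤d with ℕP.m≤n⇒m<n∨m≡n k≤d
      ... | inj₁ k<d  = ℕP.≤-<-trans (ℕP.m≤m+n (H k) (α k)) (J<m k k<d)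
      ... | inj₂ refl = subst (H d <_) H-end (subst (_≤ H d ℕ.+ 1) (ℕP.+-comm (H d) 1) ℕP.≤-refl)

      -- A run needs a step down and a step up, hence two columns.
      2≤s : 2 ≤ s
      2≤s with 2 ℕ.≤? s
      ... | yes p = p
      ... | no np = ⊥-elim (1≢-1 (trans (sym ε-end) (trans (cong ε (single-column s≤1 (c d) (c 0))) εc0)))
        where
        s≤1 : s ≤ 1
        s≤1 = ℕP.≤-pred (ℕP.≰⇒> np)
        1≢-1 : 1ℤ ≢ -1ℤ
        1≢-1 ()

      β≤J : ∀ k → k ≤ d → β k ≤ J k
      β≤J k k≤d with ℕP.m≤n⇒m<n∨m≡n k≤d | pm (c (suc k))
      ... | inj₂ refl | _ = ℕP.≤-trans (B≤1 (c d)) (subst (_≤ J d) α-end (ℕP.m≤n+m (α d) (H d)))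
      ... | inj₁ _    | inj₁ up   = subst (_≤ J k) (sym (β-up k up)) z≤n
      ... | inj₁ k<d  | inj₂ down = subst (_≤ J k) (sym (β-down k down))
              (positive (J-encodes-along k (ℕP.<⇒≤ k<d))
                (subst (λ z → ℤ.- (+ m) ℤ.≤ P k ℤ.+ z) down (P-above (suc k) k<d)))

      path-edge : ∀ k → k < d → Edge (w k) (w (suc k))
      path-edge k k<d = walk-edge k 2≤s (J<m k k<d) (β≤J k (ℕP.<⇒≤ k<d)) (H<m (suc k) k<d)

      -- The path cannot be extended: leaving w d would need J d < m, and
      -- entering w 0 (height m − 1 after a descent) would need j = m.
      no-out : ∀ z → ¬ Edge (w d) z
      no-out z E with edge⁻ E
      ... | _ , _ , _ , lt = ℕP.<-irrefl J-end (subst (λ y → y ℕ.+ α d < m) (toℕ-w d (H<m d ℕP.≤-refl)) lt)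

      no-in : ∀ z → ¬ Edge z (w 0)
      no-in (i₀ , t₀) E with edge⁻ E
      ... | _ , c0≡ , i+A≡ , lt = ℕP.<-irrefl refl (subst (_< m) i+A≡m lt)
        where
        B≡1 : B t₀ ≡ 1
        B≡1 = B-down (trans (cong ε (sym c0≡)) εc0)
        i+A≡m : toℕ i₀ ℕ.+ A t₀ ≡ m
        i+A≡m = trans i+A≡ (trans (cong₂ ℕ._+_ (toℕ-w 0 (H<m 0 z≤n)) B≡1)
                  (trans (ℕP.+-comm (m ∸ 1) 1) (ℕP.m+[n∸m]≡n m≥1)))

      path : List V
      path = applyUpTo w (suc d)

      ∈-path⁻ : ∀ {x} → x ∈ path → Σ ℕ λ k → k ≤ d × x ≡ w k
      ∈-path⁻ p with ∈-applyUpTo⁻ w p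
      ... | k , k<1+d , x≡ = k , ℕP.≤-pred k<1+d , x≡

      ∈-path⁺ : ∀ k → k ≤ d → w k ∈ path
      ∈-path⁺ k k≤d = ∈-applyUpTo⁺ w (s≤s k≤d)

      -- Being shorter than a period, the path visits distinct columns.
      path-unique : d < s → Unique path
      path-unique d<s = APP.applyUpTo⁺₁ w (suc d) λ {i} {j} i<j j<1+d eq →
        ℕP.<-irrefl (col-injective (toℕ a) i j (ℕP.<-trans i<j (ℕP.≤-trans j<1+d d<s))
          (ℕP.≤-trans j<1+d d<s) (cong proj₂ eq)) i<j

      step-closed : ∀ {y z} → y ∈ path → SymClosure Edge y z → z ∈ path
      step-closed y∈ (fwd E) with ∈-path⁻ y∈
      ... | k , k≤d , refl with ℕP.m≤n⇒m<n∨m≡n k≤d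
      ...   | inj₁ k<d  = subst (_∈ path) (edge-functional (path-edge k k<d) E) (∈-path⁺ (suc k) k<d)
      ...   | inj₂ refl = ⊥-elim (no-out _ E)
      step-closed y∈ (bwd E) with ∈-path⁻ y∈
      ... | zero  , _   , refl = ⊥-elim (no-in _ E)
      ... | suc k , k<d , refl = subst (_∈ path) (edge-injective (path-edge k k<d) E) (∈-path⁺ k (ℕP.<⇒≤ k<d))

      closed : ∀ {y z} → Conn y z → y ∈ path → z ∈ path
      closed RT.ε          y∈ = y∈
      closed (step RT.◅ p) y∈ = closed p (step-closed y∈ step)

      reach : ∀ k → k ≤ d → Conn (w 0) (w k)
      reach zero    _   = RT.ε
      reach (suc k) k<d = reach k (ℕP.<⇒≤ k<d) RT.◅◅ (fwd (path-edge k k<d) RT.◅ RT.ε)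

      component : ∀ z → Conn (w 0) z ⇔ z ∈ path
      component z = mk⇔ (λ cz → closed cz (∈-path⁺ 0 z≤n))
        (λ z∈ → case ∈-path⁻ z∈ of λ { (k , k≤d , refl) → reach k k≤d })

      edges : ∀ u x → (Edge u x × u ∈ path) ⇔ Consec u x path
      edges u x = mk⇔ to from
        where
        to : Edge u x × u ∈ path → Consec u x path
        to (E , u∈) with ∈-path⁻ u∈
        ... | k , k≤d , refl with ℕP.m≤n⇒m<n∨m≡n k≤d
        ...   | inj₁ k<d  = subst (λ y → Consec (w k) y path) (edge-functional (path-edge k k<d) E)
                              (consec⁺ w (suc d) k (s≤s k<d))
        ...   | inj₂ refl = ⊥-elim (no-out x E)
        from : Consec u x path → Edge u x × u ∈ path
        from cs with consec⁻ w (suc d) cs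
        ... | i , s≤s i<d , refl , refl = path-edge i i<d , ∈-path⁺ i (ℕP.<⇒≤ i<d)

      not-markedA : ∀ k → k ≤ d → ¬ (toℕ (proj₁ (w k)) ℕ.+ α k < β k)
      not-markedA k k≤d lt = ℕP.<⇒≱ (subst (λ y → y ℕ.+ α k < β k) (toℕ-w k (H<m k k≤d)) lt) (β≤J k k≤d)

      -- A mark of the second kind would need the walk to arrive from a column
      -- t₀ with H k + B t₀ < A t₀; but it arrives from column k − 1 having
      -- climbed from J (k − 1) ≥ A_{k−1}, or starts at height m − 1 with B = 1.
      not-markedB : ∀ k → k ≤ d → ∀ t₀ → c k ≡ next t₀ → ¬ (H k ℕ.+ B t₀ < A t₀)
      not-markedB zero _ t₀ c0≡ lt =
        ℕP.<⇒≱ lt (ℕP.≤-trans (A≤1 t₀) (subst (_≤ H 0 ℕ.+ B t₀) B≡1 (ℕP.m≤n+m (B t₀) (H 0))))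
        where
        B≡1 : B t₀ ≡ 1
        B≡1 = B-down (trans (cong ε (sym c0≡)) εc0)
      not-markedB (suc k) _ t₀ c≡ lt with next-injective (trans (c-suc k) c≡)
      ... | refl = ℕP.<⇒≱ lt (ℕP.≤-trans (ℕP.m≤n+m (α k) (H k))
                     (subst (J k ≤_) (ℕP.+-comm (β k) _) (ℕP.m≤n+m∸n (J k) (β k))))

      not-marked : ∀ k → k ≤ d → ¬ MarkedZero (w k)
      not-marked k k≤d mz with marked⁻ mz
      ... | inj₁ one-column = ℕP.<-irrefl (sym one-column) 2≤s
      ... | inj₂ (inj₁ lt) = not-markedA k k≤d lt
      ... | inj₂ (inj₂ (t₀ , c≡ , lt)) =
            not-markedB k k≤d t₀ c≡ (subst (λ y → y ℕ.+ B t₀ < A t₀) (toℕ-w k (H<m k k≤d)) lt)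

      -- For d < s the path has no repetitions, so it is a free linear component.
      free : d < s → FreeLinear (w 0)
      free d<s = (path , path-unique d<s , component , edges) ,
        λ z cz mz → case ∈-path⁻ (Equivalence.to (component z) cz) of λ
          { (k , k≤d , refl) → not-marked k k≤d mz }

      -- The only top vertex of a (−1)-column on the path is its first vertex:
      -- revisiting height m − 1 in such a column would force P = 0 before d.
      top-start-unique : ∀ {a′} → ε a′ ≡ -1ℤ → ((m ∸ 1) mod m , a′) ∈ path → a′ ≡ a
      top-start-unique {a′} εa′ mem with ∈-path⁻ mem
      ... | zero  , _   , eq = trans (cong proj₂ eq) c0
      ... | suc k , k<d , eq = ⊥-elim (ℤP.<-irrefl Pk≡0 (proj₂ (proj₂ R k k<d)))
        where
        εc : ε (c (suc k)) ≡ -1ℤ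
        εc = trans (cong ε (sym (cong proj₂ eq))) εa′
        H≡ : H (suc k) ≡ m ∸ 1
        H≡ = trans (sym (toℕ-w (suc k) (H<m (suc k) k<d)))
               (trans (cong (λ v → toℕ (proj₁ v)) (sym eq)) (toℕ-w 0 m-1<m))
        via-walk : Encodes (m ∸ 1 ℕ.+ 0) (P k ℤ.+ -1ℤ)
        via-walk = subst₂ Encodes (cong₂ ℕ._+_ H≡ (A-down εc)) (cong (λ z → P k ℤ.+ z) εc)
                     (J-encodes-along (suc k) k<d)
        via-start : Encodes (m ∸ 1 ℕ.+ 0) (0ℤ ℤ.+ -1ℤ)
        via-start = encodes-down m-encodes-0 m≥1
        Pk≡0 : P k ≡ 0ℤ
        Pk≡0 = ∙-cancelʳ -1ℤ (P k) 0ℤ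
                 (∙-cancelˡ (+ m) _ _ (trans (sym (Encodes.decode via-walk)) (Encodes.decode via-start)))

  psum-after-period : ∀ x r → psum x (s ℕ.+ r) ≡ psum x (s ∸ 1) ℤ.+ psum x r
  psum-after-period x r = begin
    psum x (s ℕ.+ r)                              ≡⟨ cong (λ z → psum x (z ℕ.+ r)) (ℕP.m+[n∸m]≡n s≥1) ⟨
    psum x (suc (s ∸ 1 ℕ.+ r))                    ≡⟨ psum-split x (s ∸ 1) r ⟩
    psum x (s ∸ 1) ℤ.+ psum (x ℕ.+ suc (s ∸ 1)) r
      ≡⟨ cong (λ z → psum x (s ∸ 1) ℤ.+ psum (x ℕ.+ z) r) (ℕP.m+[n∸m]≡n s≥1) ⟩
    psum x (s ∸ 1) ℤ.+ psum (x ℕ.+ s) r           ≡⟨ cong (λ z → psum x (s ∸ 1) ℤ.+ z) (psum-periodic x r) ⟩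
    psum x (s ∸ 1) ℤ.+ psum x r                   ∎
    where open ≡-Reasoning

  -- A free segment is shorter than a period: otherwise its final sum 0
  -- would be the sum of two negative partial sums.
  segment-short : ∀ {lam} a d → FreeSegment lam (a , d) → d < s
  segment-short a d (_ , _ , Pd≡0 , window , _) with d ℕ.<? s
  ... | yes d<s = d<s
  ... | no d≮s  = ⊥-elim (ℤP.<-irrefl (trans (sym split) Pd≡0)
                    (ℤP.+-mono-< (proj₂ (window (s ∸ 1) s-1<d)) (proj₂ (window (d ∸ s) d-s<d))))
    where
    s≤d : s ≤ d
    s≤d = ℕP.≮⇒≥ d≮s
    split : psum (toℕ a) d ≡ psum (toℕ a) (s ∸ 1) ℤ.+ psum (toℕ a) (d ∸ s)
    split = trans (cong (psum (toℕ a)) (sym (ℕP.m+[n∸m]≡n s≤d))) (psum-after-period (toℕ a) (d ∸ s))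
    d-s<d : d ∸ s < d
    d-s<d = ℕP.∸-monoʳ-< {d} {s} {0} s≥1 s≤d
    s-1<d : s ∸ 1 < d
    s-1<d = ℕP.<-≤-trans (ℕP.∸-monoʳ-< {s} {1} {0} ℕP.≤-refl s≥1) s≤d

  -- The end and the level of a free segment are determined by its start:
  -- the end is the first return to 0, the level minus the minimum before it.
  segment-determined : ∀ {lam lam′ a d d′} → FreeSegment lam (a , d) → FreeSegment lam′ (a , d′) →
    d ≡ d′ × lam ≡ lam′
  segment-determined {d = d} {d′} (_ , _ , Pd , W , i , i<d , Pi) (_ , _ , Pd′ , W′ , i′ , i′<d′ , Pi′)
    with ℕP.<-cmp d d′
  ... | tri< d<d′ _ _ = ⊥-elim (ℤP.<-irrefl Pd (proj₂ (W′ d d<d′)))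
  ... | tri> _ _ d′<d = ⊥-elim (ℤP.<-irrefl Pd′ (proj₂ (W d′ d′<d)))
  ... | tri≈ _ refl _ = refl , ℕP.≤-antisym (level≤ Pi (W′ i i<d)) (level≤ Pi′ (W i′ i′<d′))
    where
    level≤ : ∀ {l l′ p} → p ≡ ℤ.- (+ l) → ℤ.- (+ l′) ℤ.≤ p × p ℤ.< 0ℤ → l ≤ l′
    level≤ refl (lo , _) = ℤP.drop‿+≤+ (ℤP.neg-cancel-≤ lo)

  -- Being a free segment is decidable: all conditions are bounded.
  segment? : ∀ lam x → Dec (FreeSegment lam x)
  segment? lam (a , d) =
    (e (toℕ a) ℤ.≟ -1ℤ) ×-dec (e (toℕ a ℕ.+ d) ℤ.≟ 1ℤ) ×-dec (psum (toℕ a) d ℤ.≟ 0ℤ) ×-dec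
    map′ (λ h i → h {i}) (λ h {i} → h i) (ℕP.allUpTo? in-window? d) ×-dec
    ℕP.anyUpTo? (λ i → psum (toℕ a) i ℤ.≟ ℤ.- (+ lam)) d
    where
    in-window? : ∀ i → Dec (ℤ.- (+ lam) ℤ.≤ psum (toℕ a) i × psum (toℕ a) i ℤ.< 0ℤ)
    in-window? i = (ℤ.- (+ lam) ℤ.≤? psum (toℕ a) i) ×-dec (psum (toℕ a) i ℤ.<? 0ℤ)

  -- Partial sums cannot stay in [−m, 0) for m + 1 full periods, as each
  -- period contributes a negative amount.
  full-periods : ℕ → ℕ
  full-periods j = j ℕ.* s ℕ.+ (s ∸ 1)

  cannot-stay-negative : ∀ x → ¬ (∀ i → i ≤ full-periods m → ℤ.- (+ m) ℤ.≤ psum x i × psum x i ℤ.< 0ℤ)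
  cannot-stay-negative x window =
    -[1+m]<-m m (ℤP.≤-trans (proj₁ (window (full-periods m) ℕP.≤-refl)) (drop m ℕP.≤-refl))
    where
    period<0 : psum x (s ∸ 1) ℤ.≤ -1ℤ
    period<0 = negative⇒≤-1 (proj₂ (window (s ∸ 1) (ℕP.m≤n+m (s ∸ 1) (m ℕ.* s))))
    drop : ∀ j → j ≤ m → psum x (full-periods j) ℤ.≤ -[1+ j ]
    drop zero    _   = period<0
    drop (suc j) j<m = subst (ℤ._≤ -[1+ suc j ]) (sym split) (ℤP.+-mono-≤ period<0 (drop j (ℕP.<⇒≤ j<m)))
      where
      split : psum x (full-periods (suc j)) ≡ psum x (s ∸ 1) ℤ.+ psum x (full-periods j)
      split = trans (cong (psum x) (ℕP.+-assoc s (j ℕ.* s) (s ∸ 1))) (psum-after-period x (full-periods j))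

  -- From here on m ≥ 1; the representative of the component belonging to a
  -- free segment starting at column t is the top vertex x_{m−1,t}.
  module Components (m≥1 : 1 ≤ m) where
    instance
      nzm : NonZero m
      nzm = ℕ.>-nonZero m≥1

    open Encoding m

    top : Fin s × ℕ → V
    top (t , _) = ((m ∸ 1) mod m , t)

    Segment : Fin s × ℕ → Set
    Segment x = Σ ℕ λ lam → 1 ≤ lam × lam ≤ m × FreeSegment lam x

    segment⇒run : ∀ {lam t d} → lam ≤ m → FreeSegment lam (t , d) → Σ (ε t ≡ -1ℤ) λ εt → Walk.Run t εt d
    segment⇒run {t = t} lam≤m (ε≡ , _ , Pd , W , _) = εt , Pd , λ i i<d →
        ℤP.≤-trans (ℤP.neg-mono-≤ (ℤ.+≤+ lam≤m)) (proj₁ (W i i<d)) , proj₂ (W i i<d)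
      where
      εt : ε t ≡ -1ℤ
      εt = trans (cong ε (sym (col-toℕ t))) ε≡

    run⇒segment : ∀ t εt d → Walk.Run t εt d → Segment (t , d)
    run⇒segment t εt d R with minimiser (Walk.P t εt) d (Walk.Along.d≥1 t εt d R)
    ... | i , i<d , min with negative-view (Walk.P t εt i) (proj₂ (proj₂ R i i<d))
    ... | q , Pi = suc q , s≤s z≤n , level≤m ,
          (Walk.P0 t εt , Walk.Along.ε-end t εt d R , proj₁ R ,
           (λ j j<d → subst (ℤ._≤ Walk.P t εt j) Pi (min j j<d) , proj₂ (proj₂ R j j<d)) , i , i<d , Pi)
      where
      level≤m : suc q ≤ m
      level≤m = ℤP.drop‿+≤+ (ℤP.neg-cancel-≤ (subst (ℤ.- (+ m) ℤ.≤_) Pi (proj₁ (proj₂ R i i<d))))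

    w0≡top : ∀ t εt → Walk.w t εt 0 ≡ top (t , 0)
    w0≡top t εt = cong ((m ∸ 1) mod m ,_) (Walk.c0 t εt)

    segment-free : ∀ {x} → Segment x → FreeLinear (top x)
    segment-free {t , d} (lam , _ , lam≤m , fs) with segment⇒run lam≤m fs
    ... | εt , R = subst FreeLinear (w0≡top t εt) (Walk.Along.free t εt d R (segment-short t d fs))

    segments-separated : ∀ {x y} → Segment x → Segment y → Conn (top x) (top y) → x ≡ y
    segments-separated {t , d} {t′ , d′} (_ , _ , lam≤m , fs) (_ , _ , lam′≤m , fs′) conn
      with segment⇒run lam≤m fs | segment⇒run lam′≤m fs′
    ... | εt , R | εt′ , _ with Walk.Along.top-start-unique t εt d R εt′
          (Equivalence.to (Walk.Along.component t εt d R (top (t′ , d′)))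
            (subst (λ z → Conn z (top (t′ , d′))) (sym (w0≡top t εt)) conn))
    ... | refl = cong (t ,_) (proj₁ (segment-determined fs fs′))

    -- A vertex entering column next t₀ with no incoming edge and no mark is
    -- the top vertex of a (−1)-column: with j = i + B_{t₀} < m there would
    -- be an edge from column t₀ (if A_{t₀} ≤ j) or a mark (if j < A_{t₀}).
    entry-is-top : 2 ≤ s → ∀ i t₀ → (∀ z → ¬ Edge z (i , next t₀)) → ¬ MarkedZero (i , next t₀) →
      toℕ i ≡ m ∸ 1 × ε (next t₀) ≡ -1ℤ
    entry-is-top 2≤s i t₀ no-in unmarked with toℕ i ℕ.+ B t₀ ℕ.<? m
    ... | yes j<m with A t₀ ℕ.≤? toℕ i ℕ.+ B t₀
    ...   | yes A≤j =
      ⊥-elim (no-in (i′ , t₀) (edge t₀ j i′ i 2≤s j<m A≤j (ℕP.m≤n+m (B t₀) (toℕ i)) toℕ-i′ i≡j∸B))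
      where
      j : ℕ
      j = toℕ i ℕ.+ B t₀
      i′ : Fin m
      i′ = (j ∸ A t₀) mod m
      toℕ-i′ : toℕ i′ ≡ j ∸ A t₀
      toℕ-i′ = trans (FP.toℕ-fromℕ< (m%n<n (j ∸ A t₀) m)) (m<n⇒m%n≡m (ℕP.≤-<-trans (ℕP.m∸n≤m j (A t₀)) j<m))
      i≡j∸B : toℕ i ≡ j ∸ B t₀
      i≡j∸B = sym (ℕP.m+n∸n≡m (toℕ i) (B t₀))
    ...   | no A≰j = ⊥-elim (unmarked (zeroB t₀ (toℕ i ℕ.+ B t₀) i 2≤s j<m (ℕP.m≤n+m (B t₀) (toℕ i))
                                  (ℕP.≰⇒> A≰j) (sym (ℕP.m+n∸n≡m (toℕ i) (B t₀)))))
    entry-is-top 2≤s i t₀ no-in unmarked | no j≮m with pm (next t₀)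
    ... | inj₁ up   = ⊥-elim (j≮m (subst (_< m)
                                   (sym (trans (cong (toℕ i ℕ.+_) (B-up up)) (ℕP.+-identityʳ (toℕ i))))
                                   (FP.toℕ<n i)))
    ... | inj₂ down = i≡m-1 , down
      where
      i+1≡m : toℕ i ℕ.+ 1 ≡ m
      i+1≡m = ℕP.≤-antisym (subst (_≤ m) (ℕP.+-comm 1 (toℕ i)) (FP.toℕ<n i))
                (subst (m ≤_) (cong (toℕ i ℕ.+_) (B-down down)) (ℕP.≮⇒≥ j≮m))
      i≡m-1 : toℕ i ≡ m ∸ 1
      i≡m-1 = trans (sym (ℕP.m+n∸n≡m (toℕ i) 1)) (cong (_∸ 1) i+1≡m)

    head-is-top : ∀ i t → (∀ z → ¬ Edge z (i , t)) → ¬ MarkedZero (i , t) →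
      2 ≤ s × toℕ i ≡ m ∸ 1 × ε t ≡ -1ℤ
    head-is-top i t no-in unmarked with 2 ℕ.≤? s
    ... | no s≱2 = ⊥-elim (unmarked (s≡1 (i , t) (ℕP.≤-antisym (ℕP.≤-pred (ℕP.≰⇒> s≱2)) s≥1)))
    ... | yes 2≤s = 2≤s , subst (λ t′ → toℕ i ≡ m ∸ 1 × ε t′ ≡ -1ℤ) (next-prev t)
        (entry-is-top 2≤s i (prev t) (subst (λ t′ → ∀ z → ¬ Edge z (i , t′)) (sym (next-prev t)) no-in)
                                     (subst (λ t′ → ¬ MarkedZero (i , t′)) (sym (next-prev t)) unmarked))

    -- Follow the walk from a top vertex reachable from a free component:
    -- while the partial sums stay in [−m, 0) the walk keeps taking edges
    -- inside the component (a forced drop below height 0 would hit a vertex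
    -- marked zero), so it either completes a run or stays in the window
    -- forever, which is impossible.
    module Follow (v : V) (unmarked : ∀ z → Conn v z → ¬ MarkedZero z)
        (t : Fin s) (εt : ε t ≡ -1ℤ) (2≤s : 2 ≤ s) (v⇝top : Conn v (top (t , 0))) where
      open Walk t εt hiding (m≥1)

      Window : ℕ → Set
      Window k = ∀ j → j ≤ k → ℤ.- (+ m) ℤ.≤ P j × P j ℤ.< 0ℤ

      Progress : ℕ → Set
      Progress k = (Σ ℕ λ d → d ≤ k × Run d) ⊎ (Window k × Conn v (w k))

      encodes-in : ∀ {k} → Window k → Encodes (J k) (P k)
      encodes-in {k} win = J-encodes k (λ j j≤k → proj₁ (win j j≤k))

      advance : ∀ k → Window (suc k) → Conn v (w k) → β k ≤ J k → Progress (suc k)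
      advance k win v⇝w le = inj₂ (win , v⇝w RT.◅◅ (fwd E RT.◅ RT.ε))
        where
        win-k : Window k
        win-k j j≤k = win j (ℕP.m≤n⇒m≤1+n j≤k)
        E : Edge (w k) (w (suc k))
        E = walk-edge k 2≤s (below-m (encodes-in win-k) (proj₂ (win k (ℕP.m≤n⇒m≤1+n ℕP.≤-refl)))) le
              (ℕP.≤-<-trans (ℕP.m≤m+n _ _) (below-m (encodes-in win) (proj₂ (win (suc k) ℕP.≤-refl))))

      extend : ∀ {k} → Window k → ℤ.- (+ m) ℤ.≤ P (suc k) → P (suc k) ℤ.< 0ℤ → Window (suc k)
      extend win lo hi j j≤1+k with ℕP.m≤n⇒m<n∨m≡n j≤1+k
      ... | inj₁ j<1+k = win j (ℕP.≤-pred j<1+k)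
      ... | inj₂ refl  = lo , hi

      step-up : ∀ k → Window k → Conn v (w k) → ε (c (suc k)) ≡ 1ℤ → Progress (suc k)
      step-up k win v⇝w up with P (suc k) ℤ.≟ 0ℤ
      ... | yes P≡0 = inj₁ (suc k , ℕP.≤-refl , P≡0 , λ j j<1+k → win j (ℕP.≤-pred j<1+k))
      ... | no P≢0 = advance k (extend win lo hi) v⇝w (subst (_≤ J k) (sym (β-up k up)) z≤n)
        where
        Pk : ℤ.- (+ m) ℤ.≤ P k × P k ℤ.< 0ℤ
        Pk = win k ℕP.≤-refl
        P≡ : P (suc k) ≡ P k ℤ.+ 1ℤ
        P≡ = cong (λ z → P k ℤ.+ z) up
        lo : ℤ.- (+ m) ℤ.≤ P (suc k)
        lo = subst (ℤ.- (+ m) ℤ.≤_) (sym P≡) (ℤP.≤-trans (proj₁ Pk) (ℤP.i≤i+j (P k) 1ℤ))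
        hi : P (suc k) ℤ.< 0ℤ
        hi = ℤP.≤∧≢⇒< (subst (ℤ._≤ 0ℤ) (sym P≡) (ℤP.+-monoˡ-≤ 1ℤ (negative⇒≤-1 (proj₂ Pk)))) P≢0

      -- A step down keeps the sums in the window unless the height is 0,
      -- where the walk would sit on a vertex marked zero.
      step-down : ∀ k → Window k → Conn v (w k) → ε (c (suc k)) ≡ -1ℤ → Progress (suc k)
      step-down k win v⇝w down with 1 ℕ.≤? J k
      ... | yes J≥1 = advance k (extend win lo hi) v⇝w (subst (_≤ J k) (sym (β-down k down)) J≥1)
        where
        P≡ : P (suc k) ≡ P k ℤ.+ -1ℤ
        P≡ = cong (λ z → P k ℤ.+ z) down
        lo : ℤ.- (+ m) ℤ.≤ P (suc k)
        lo = subst (ℤ.- (+ m) ℤ.≤_) (sym P≡) (above-−m (encodes-down (encodes-in win) J≥1))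
        hi : P (suc k) ℤ.< 0ℤ
        hi = subst (ℤ._< 0ℤ) (sym P≡) (ℤP.<-trans (subst (P k ℤ.+ -1ℤ ℤ.<_) (ℤP.+-identityʳ (P k))
               (ℤP.+-monoʳ-< (P k) (ℤ.-<+ {0} {0}))) (proj₂ (win k ℕP.≤-refl)))
      ... | no J≱1 = ⊥-elim (unmarked (w k) v⇝w (markedA⁺ (c k) (proj₁ (w k)) 2≤s
                (subst (λ z → z ℕ.+ α k < m) (sym toℕ-wk) J<m)
                (subst (λ z → z ℕ.+ α k < β k) (sym toℕ-wk)
                  (subst (J k <_) (sym (β-down k down)) (ℕP.≰⇒> J≱1)))))
        where
        J<m : J k < m
        J<m = below-m (encodes-in win) (proj₂ (win k ℕP.≤-refl))
        toℕ-wk : toℕ (proj₁ (w k)) ≡ H k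
        toℕ-wk = toℕ-w k (ℕP.≤-<-trans (ℕP.m≤m+n (H k) (α k)) J<m)

      progress : ∀ k → Progress k
      progress zero = inj₂ (window₀ , subst (Conn v) (sym (w0≡top t εt)) v⇝top)
        where
        window₀ : Window 0
        window₀ zero _ =
          subst (ℤ.- (+ m) ℤ.≤_) (sym P0) (ℤP.neg-mono-≤ (ℤ.+≤+ m≥1)) , subst (ℤ._< 0ℤ) (sym P0) ℤ.-<+
      progress (suc k) with progress k
      ... | inj₁ (d , d≤k , R) = inj₁ (d , ℕP.m≤n⇒m≤1+n d≤k , R)
      ... | inj₂ (win , v⇝w) with pm (c (suc k))
      ...   | inj₁ up   = step-up k win v⇝w up
      ...   | inj₂ down = step-down k win v⇝w down

      segment : Σ (Fin s × ℕ) λ x → Segment x × Conn v (top x)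
      segment with progress (full-periods m)
      ... | inj₁ (d , _ , R) = (t , d) , run⇒segment t εt d R , v⇝top
      ... | inj₂ (win , _)   = ⊥-elim (cannot-stay-negative (toℕ t) win)

    consec-target-in-tail : ∀ {z u} {rest : List V} → Consec z u (u ∷ rest) → u ∈ rest
    consec-target-in-tail here      = here refl
    consec-target-in-tail (there p) = second p
      where
      second : ∀ {z u} {xs : List V} → Consec z u xs → u ∈ xs
      second here      = there (here refl)
      second (there q) = there (second q)

    component-head : ∀ v → Linear v → Σ V λ u → Conn v u × (∀ z → ¬ Edge z u)
    component-head v ([] , _ , comp , _) = ⊥-elim (case Equivalence.to (comp v) RT.ε of λ ())
    component-head v (u ∷ rest , (u∉rest ∷ _) , comp , edges) = u , v⇝u , no-in
      where
      v⇝u : Conn v u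
      v⇝u = Equivalence.from (comp u) (here refl)
      no-in : ∀ z → ¬ Edge z u
      no-in z E = All.lookup u∉rest (consec-target-in-tail (Equivalence.to (edges z u)
        (E , Equivalence.to (comp z) (v⇝u RT.◅◅ (bwd E RT.◅ RT.ε))))) refl

    -- Every free linear component contains the top vertex of a segment:
    -- its first vertex is such a top vertex, and following the walk from it
    -- produces a run.
    component-segment : ∀ v → FreeLinear v → Σ (Fin s × ℕ) λ x → Segment x × Conn v (top x)
    component-segment v (lin , unmarked) with component-head v lin
    ... | (i , t) , v⇝head , no-in with head-is-top i t no-in (unmarked _ v⇝head)
    ... | 2≤s , i≡m-1 , εt = Follow.segment v unmarked t εt 2≤s (subst (Conn v) head≡top v⇝head)
      where
      head≡top : (i , t) ≡ top (t , 0)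
      head≡top = cong (_, t) (FP.toℕ-injective (trans i≡m-1 (sym (Walk.toℕ-w t εt 0 (Walk.m-1<m t εt)))))

    candidates : List (Fin s × ℕ)
    candidates = cartesianProduct (allFin s) (upTo s)

    segments-of-level : ℕ → List (Fin s × ℕ)
    segments-of-level lam = filter (segment? lam) candidates

    segment-count : ℕ → ℕ
    segment-count lam = length (segments-of-level lam)

    segments-of-level-unique : ∀ lam → Unique (segments-of-level lam)
    segments-of-level-unique lam = UP.filter⁺ (segment? lam) (UP.cartesianProduct⁺ (UP.allFin⁺ s) (UP.upTo⁺ s))

    ∈-segments-of-level : ∀ lam x → x ∈ segments-of-level lam ⇔ FreeSegment lam x
    ∈-segments-of-level lam (t , d) = mk⇔ (λ p → proj₂ (∈-filter⁻ (segment? lam) {xs = candidates} p))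
      (λ fs → ∈-filter⁺ (segment? lam) (∈-cartesianProduct⁺ (∈-allFin t) (∈-upTo⁺ (segment-short t d fs))) fs)

    count-segments : ∀ lam → NumSegments lam (segment-count lam)
    count-segments lam = segments-of-level lam , refl , segments-of-level-unique lam , ∈-segments-of-level lam

    -- All free segments of levels 1, …, k, without repetition (a segment has one level).
    segments-upto : ℕ → List (Fin s × ℕ)
    segments-upto zero    = []
    segments-upto (suc k) = segments-upto k ++ segments-of-level (suc k)

    length-segments-upto : ∀ k → length (segments-upto k) ≡ sum1to k segment-count
    length-segments-upto zero    = refl
    length-segments-upto (suc k) =
      trans (length-++ (segments-upto k)) (cong (ℕ._+ segment-count (suc k)) (length-segments-upto k))

    ∈-segments-upto⁻ : ∀ k {x} → x ∈ segments-upto k → Σ ℕ λ lam → 1 ≤ lam × lam ≤ k × FreeSegment lam x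
    ∈-segments-upto⁻ (suc k) p with ∈-++⁻ (segments-upto k) p
    ... | inj₁ q with ∈-segments-upto⁻ k q
    ...   | lam , 1≤lam , lam≤k , fs = lam , 1≤lam , ℕP.m≤n⇒m≤1+n lam≤k , fs
    ∈-segments-upto⁻ (suc k) p | inj₂ q =
      suc k , s≤s z≤n , ℕP.≤-refl , Equivalence.to (∈-segments-of-level (suc k) _) q

    ∈-segments-upto⁺ : ∀ k {x lam} → 1 ≤ lam → lam ≤ k → FreeSegment lam x → x ∈ segments-upto k
    ∈-segments-upto⁺ zero {lam = zero}  ()  _  _
    ∈-segments-upto⁺ zero {lam = suc _} _   () _
    ∈-segments-upto⁺ (suc k) {x} 1≤lam lam≤1+k fs with ℕP.m≤n⇒m<n∨m≡n lam≤1+k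
    ... | inj₁ lam<1+k = ∈-++⁺ˡ (∈-segments-upto⁺ k 1≤lam (ℕP.≤-pred lam<1+k) fs)
    ... | inj₂ refl    = ∈-++⁺ʳ (segments-upto k) (Equivalence.from (∈-segments-of-level (suc k) x) fs)

    segments-upto-unique : ∀ k → Unique (segments-upto k)
    segments-upto-unique zero    = []
    segments-upto-unique (suc k) =
      UP.++⁺ (segments-upto-unique k) (segments-of-level-unique (suc k)) λ (p , q) → disjoint p q
      where
      disjoint : ∀ {x} → x ∈ segments-upto k → x ∈ segments-of-level (suc k) → ⊥
      disjoint p q with ∈-segments-upto⁻ k p
      ... | _ , _ , lam≤k , fs =
        ℕP.<-irrefl (proj₂ (segment-determined fs (Equivalence.to (∈-segments-of-level (suc k) _) q))) (s≤s lam≤k)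

    count-components : NumFreeLinear (sum1to m segment-count)
    count-components = map top (segments-upto m) ,
      trans (length-map top (segments-upto m)) (length-segments-upto m) ,
      AllP.map⁺ (All.tabulate (λ p → segment-free (∈-segments-upto⁻ m p))) ,
      APP.map⁺ (unique⇒allPairs Segment (All.tabulate (∈-segments-upto⁻ m)) (segments-upto-unique m)
        (λ sx sy x≢y conn → x≢y (segments-separated sx sy conn))) ,
      λ v fl → case component-segment v fl of λ { (x , (lam , 1≤lam , lam≤m , fs) , v⇝top) →
        Any.map (λ eq → subst (Conn v) eq v⇝top) (∈-map⁺ top (∈-segments-upto⁺ m 1≤lam lam≤m fs)) }

theorem4p11 : (m s : ℕ) .{{_ : NonZero s}} (ε : Fin s → ℤ) →
    1 ≤ m →
    (∀ i → ε i ≡ 1ℤ ⊎ ε i ≡ -1ℤ) →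
    Σ ℕ λ ℓ → Graph.NumFreeLinear m s ε ℓ ×
      Σ (ℕ → ℕ) λ a →
        (∀ lam → 1 ≤ lam → lam ≤ m → Graph.NumSegments m s ε lam (a lam)) ×
        ℓ ≡ sum1to m a
theorem4p11 m s ε m≥1 pm =
  sum1to m segment-count , count-components , segment-count , (λ lam _ _ → count-segments lam) , refl
  where open PlusMinus.Components m s ε pm m≥1
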